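{- The sequence $2,3,5,8,13,\ldots$ (i.e. $(F_{n+2})_{n\ge0}$) is totally greedy: for every integer $t\ge 3$, the set $S^{(t)}=\{F_2,F_3,\dots,F_t\}=\{2,3,5,\dots,F_t\}$ is greedy.
   Context: $(F_n)_{n\ge0}$ is the Fibonacci sequence with $F_0=F_1=1$ and $F_{n+1}=F_n+F_{n-1}$, so $F_2=2$, $F_3=3$, $F_4=5$, etc. For a finite set $S=\{s_1<s_2<\dots<s_t\}$ of positive integers with $\gcd(s_1,\dots,s_t)=1$, let $\langle S\rangle=\{\sum_i\alpha_is_i:\alpha_i\in\mathbb{N}_0\}$ be the numerical semigroup it generates. For $k\in\langle S\rangle$, a representation of $k$ is a vector $(a_1,\dots,a_t)\in\mathbb{N}_0^t$ with $\sum_i a_is_i=k$; its cost is $\sum_i a_i$, and $\mathrm{MinCost}_S(k)$ is the minimum cost over all representations of $k$. The greedy representation of $k$ is produced as follows: set all $a_i=0$ and $i=t$; while $k>0$, let $q$ be the largest nonnegative integer such that $k=qs_i+r$ with $r\in\langle S\rangle$, set $a_i=q$, $k\leftarrow r$, $i\leftarrow i-1$. $\mathrm{GreedyCost}_S(k)$ is the cost of the greedy representation. $S$ is called greedy if $\mathrm{GreedyCost}_S(k)=\mathrm{MinCost}_S(k)$ for every $k\in\langle S\rangle$. A strictly increasing sequence is totally greedy if all its prefix sets are greedy. -}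

module Defs where

open import Data.Nat using (ℕ; zero; suc; _+_; _*_; _∸_; _≤_; _<_)
open import Data.List using (List; []; _∷_; length; map; upTo; reverse)
open import Data.Nat.ListAction using (sum)
open import Data.Product using (Σ; _×_; ∃; ∃-syntax)
open import Relation.Nullary using (¬_)
open import Relation.Binary.PropositionalEquality using (_≡_)

fib : ℕ → ℕ
fib zero = 1
fib (suc zero) = 1
fib (suc (suc n)) = fib (suc n) + fib n

-- generators s_1 < ... < s_t are given as a list [s_1, ..., s_t]
-- a representation vector (a_1,...,a_t) is a list of the same length
dot : List ℕ → List ℕ → ℕ
dot (a ∷ as) (s ∷ ss) = a * s + dot as ss
dot _ _ = 0

cost : List ℕ → ℕ
cost = sum

IsRep : List ℕ → ℕ → List ℕ → Set
IsRep S k a = (length a ≡ length S) × (dot a S ≡ k)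

InSG : List ℕ → ℕ → Set
InSG S k = ∃[ a ] IsRep S k a

IsMinCost : List ℕ → ℕ → ℕ → Set
IsMinCost S k c = (∃[ a ] (IsRep S k a × cost a ≡ c))
                × (∀ a → IsRep S k a → c ≤ cost a)

-- GreedyRun S gs k c : running the greedy loop (membership tested in ⟨S⟩)
-- on the remaining generators gs (in decreasing order, s_i first), starting
-- from current value k, terminates (k reaches 0) with accumulated cost c.
data GreedyRun (S : List ℕ) : List ℕ → ℕ → ℕ → Set where
  done : ∀ {gs} → GreedyRun S gs 0 0
  step : ∀ {s gs k q c} → 0 < k →
         q * s ≤ k → InSG S (k ∸ q * s) →
         (∀ q′ → q < q′ → q′ * s ≤ k → ¬ InSG S (k ∸ q′ * s)) →
         GreedyRun S gs (k ∸ q * s) c →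
         GreedyRun S (s ∷ gs) k (q + c)

IsGreedyCost : List ℕ → ℕ → ℕ → Set
IsGreedyCost S k c = GreedyRun S (reverse S) k c

IsGreedy : List ℕ → Set
IsGreedy S = ∀ k → InSG S k → ∃[ c ] (IsGreedyCost S k c × IsMinCost S k c)

fibSet : ℕ → List ℕ
fibSet t = map (λ i → fib (suc (suc i))) (upTo (t ∸ 1))

-- Every coin set involved generates ℕ ∖ {1}. Call x costly over a coin list C when adding x
-- to any y ≠ 1 strictly raises the minimum cost. If the greedy algorithm is optimal on C and
-- the next coin b is costly over C, it stays optimal on b ∷ C: with q the greedy quotient,
-- a representation using j ≤ q copies of b represents the greedy remainder plus (q − j)·b
-- with the other coins, so it costs at least j + (q − j) + MinCost(remainder). Costliness
-- propagates up the Fibonacci numbers through F_{n+1} + F_{n−2} = 2·F_n: a representation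
-- of y + F_{n+1} plus the single coin F_{n−2} represents y + 2·F_n, which costs at least two
-- more than y. The induction starts at {2, 3}, settled by hand, since {2} alone generates
-- only the even numbers.

module Submission where

open import Defs
open import Data.Nat using (ℕ; zero; suc; _+_; _*_; _∸_; _≤_; _<_; z≤n; s≤s; s≤s⁻¹; z<s; _≤?_; _≟_; >-nonZero)
open import Data.Nat.Properties
open import Data.Nat.ListAction.Properties using (sum-↭)
open import Data.List using (List; []; _∷_; length; reverse; replicate; applyDownFrom; zipWith; _∷ʳ_)
open import Data.List.Properties using (unfold-reverse; length-reverse; reverse-involutive; map-upTo; reverse-applyUpTo)
open import Data.List.Relation.Binary.Permutation.Propositional.Properties using (↭-reverse)
open import Data.List.Relation.Unary.All using (All; []; _∷_; universal)
open import Data.List.Relation.Unary.All.Properties using (map⁺; applyDownFrom⁺₂)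
open import Data.Product using (_×_; ∃-syntax; _,_; proj₁; proj₂)
open import Data.Sum using (inj₁; inj₂)
open import Function using (_∘_)
open import Relation.Nullary using (¬_; yes; no; contradiction)
open import Relation.Nullary.Decidable using (_×-dec_; map′; ¬?)
open import Relation.Unary using (Pred; Decidable)
open import Relation.Binary.PropositionalEquality
open import Algebra.Properties.CommutativeSemigroup +-commutativeSemigroup using (interchange)
open import Data.Nat.Tactic.RingSolver using (solve-∀)

dot-∷ʳ : ∀ a s x y → length a ≡ length s → dot (a ∷ʳ x) (s ∷ʳ y) ≡ dot a s + x * y
dot-∷ʳ []      []      x y _ = +-identityʳ (x * y)
dot-∷ʳ (b ∷ a) (t ∷ s) x y e =
  trans (cong (b * t +_) (dot-∷ʳ a s x y (suc-injective e))) (sym (+-assoc (b * t) _ _))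

dot-reverse : ∀ a s → length a ≡ length s → dot (reverse a) (reverse s) ≡ dot a s
dot-reverse []      []      _ = refl
dot-reverse (x ∷ a) (y ∷ s) e = begin
  dot (reverse (x ∷ a)) (reverse (y ∷ s)) ≡⟨ cong₂ dot (unfold-reverse x a) (unfold-reverse y s) ⟩
  dot (reverse a ∷ʳ x) (reverse s ∷ʳ y)   ≡⟨ dot-∷ʳ (reverse a) (reverse s) x y lengths ⟩
  dot (reverse a) (reverse s) + x * y     ≡⟨ cong (_+ x * y) (dot-reverse a s (suc-injective e)) ⟩
  dot a s + x * y                         ≡⟨ +-comm (dot a s) (x * y) ⟩
  x * y + dot a s                         ∎
  where
  open ≡-Reasoning
  lengths : length (reverse a) ≡ length (reverse s)
  lengths = trans (length-reverse a) (trans (suc-injective e) (sym (length-reverse s)))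

cost-reverse : ∀ a → cost (reverse a) ≡ cost a
cost-reverse a = sum-↭ (↭-reverse a)

IsRep-reverse : ∀ S a {k} → IsRep S k a → IsRep (reverse S) k (reverse a)
IsRep-reverse S a (len , eq) =
  trans (length-reverse a) (trans len (sym (length-reverse S))) , trans (dot-reverse a S len) eq

IsMinCost-reverse : ∀ {S k c} → IsMinCost (reverse S) k c → IsMinCost S k c
IsMinCost-reverse {S} {k} {c} ((a , rep , cost-a) , minimal) =
  (reverse a , subst (λ T → IsRep T k (reverse a)) (reverse-involutive S) (IsRep-reverse (reverse S) a rep) ,
   trans (cost-reverse a) cost-a) ,
  λ b rep′ → subst (c ≤_) (cost-reverse b) (minimal (reverse b) (IsRep-reverse S b rep′))

dot-zipWith-+ : ∀ a b s → length a ≡ length b → dot (zipWith _+_ a b) s ≡ dot a s + dot b s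
dot-zipWith-+ []      []      s       _ = refl
dot-zipWith-+ (x ∷ a) (y ∷ b) []      _ = refl
dot-zipWith-+ (x ∷ a) (y ∷ b) (t ∷ s) e = begin
  (x + y) * t + dot (zipWith _+_ a b) s
    ≡⟨ cong₂ _+_ (*-distribʳ-+ t x y) (dot-zipWith-+ a b s (suc-injective e)) ⟩
  (x * t + y * t) + (dot a s + dot b s)   ≡⟨ interchange (x * t) (y * t) (dot a s) (dot b s) ⟩
  (x * t + dot a s) + (y * t + dot b s)   ∎
  where open ≡-Reasoning

cost-zipWith-+ : ∀ a b → length a ≡ length b → cost (zipWith _+_ a b) ≡ cost a + cost b
cost-zipWith-+ []      []      _ = refl
cost-zipWith-+ (x ∷ a) (y ∷ b) e =
  trans (cong (x + y +_) (cost-zipWith-+ a b (suc-injective e))) (interchange x y (cost a) (cost b))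

length-zipWith-+ : ∀ a b → length a ≡ length b → length (zipWith _+_ a b) ≡ length a
length-zipWith-+ []      []      _ = refl
length-zipWith-+ (x ∷ a) (y ∷ b) e = cong suc (length-zipWith-+ a b (suc-injective e))

IsRep-+ : ∀ {S u v} a b → IsRep S u a → IsRep S v b → IsRep S (u + v) (zipWith _+_ a b)
IsRep-+ {S} a b (len-a , eq-a) (len-b , eq-b) =
  trans (length-zipWith-+ a b same-length) len-a ,
  trans (dot-zipWith-+ a b S same-length) (cong₂ _+_ eq-a eq-b)
  where
  same-length : length a ≡ length b
  same-length = trans len-a (sym len-b)

zeros : List ℕ → List ℕ
zeros S = replicate (length S) 0

IsRep-zeros : ∀ S → IsRep S 0 (zeros S)
IsRep-zeros []      = refl , refl
IsRep-zeros (s ∷ S) = cong suc (proj₁ (IsRep-zeros S)) , proj₂ (IsRep-zeros S)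

cost-zeros : ∀ S → cost (zeros S) ≡ 0
cost-zeros []      = refl
cost-zeros (s ∷ S) = cost-zeros S

IsMinCost-0 : ∀ S → IsMinCost S 0 0
IsMinCost-0 S = (zeros S , IsRep-zeros S , cost-zeros S) , λ _ _ → z≤n

≥2⇒≢1 : ∀ {n} → 2 ≤ n → n ≢ 1
≥2⇒≢1 n≥2 refl = contradiction n≥2 λ { (s≤s ()) }

dot≢1 : ∀ {S} → All (2 ≤_) S → ∀ a → dot a S ≢ 1
dot≢1 []         []            ()
dot≢1 []         (_ ∷ _)       ()
dot≢1 (_ ∷ _)    []            ()
dot≢1 (_ ∷ S≥2)  (zero ∷ a)    = dot≢1 S≥2 a
dot≢1 {s ∷ S} (s≥2 ∷ _) (suc x ∷ a) eq =
  ≥2⇒≢1 (≤-trans s≥2 (m≤m+n s (x * s + dot a S))) (trans (sym (+-assoc s _ _)) eq)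

twos-and-threes : ∀ x → x ≢ 1 → ∃[ i ] ∃[ j ] (i * 2 + j * 3 ≡ x)
twos-and-threes 0 _ = 0 , 0 , refl
twos-and-threes 1 x≢1 = contradiction refl x≢1
twos-and-threes 2 _ = 1 , 0 , refl
twos-and-threes 3 _ = 0 , 1 , refl
twos-and-threes (suc (suc x@(suc (suc _)))) _ with twos-and-threes x (λ ())
... | i , j , eq = suc i , j , cong (λ z → suc (suc z)) eq

≢1⇒InSG : ∀ S {x} → x ≢ 1 → InSG (2 ∷ 3 ∷ S) x
≢1⇒InSG S {x} x≢1 with twos-and-threes x x≢1
... | i , j , eq = i ∷ j ∷ zeros S , cong (λ z → suc (suc z)) (proj₁ (IsRep-zeros S)) , (begin
  i * 2 + (j * 3 + dot (zeros S) S) ≡⟨ cong (λ z → i * 2 + (j * 3 + z)) (proj₂ (IsRep-zeros S)) ⟩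
  i * 2 + (j * 3 + 0)               ≡⟨ cong (i * 2 +_) (+-identityʳ (j * 3)) ⟩
  i * 2 + j * 3                     ≡⟨ eq ⟩
  x                                 ∎)
  where open ≡-Reasoning

largest : ∀ {p} {P : Pred ℕ p} → Decidable P → P 0 → ∀ n →
          ∃[ q ] (q ≤ n × P q × (∀ q′ → q < q′ → q′ ≤ n → ¬ P q′))
largest P? P0 zero = 0 , z≤n , P0 , λ { _ (s≤s _) () }
largest {P = P} P? P0 (suc n) with P? (suc n)
... | yes P[1+n] = suc n , ≤-refl , P[1+n] , λ q′ n<q′ q′≤n → contradiction q′≤n (<⇒≱ n<q′)
... | no ¬P[1+n] with largest P? P0 n
...   | q , q≤n , Pq , above = q , m≤n⇒m≤1+n q≤n , Pq , beyond
  where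
  beyond : ∀ q′ → q < q′ → q′ ≤ suc n → ¬ P q′
  beyond q′ q<q′ q′≤1+n with m≤n⇒m<n∨m≡n q′≤1+n
  ... | inj₁ q′<1+n = above q′ q<q′ (s≤s⁻¹ q′<1+n)
  ... | inj₂ refl   = ¬P[1+n]

greedyQuotient : ∀ {p} {P : Pred ℕ p} → Decidable P → ∀ {b} → 0 < b → ∀ k → P k →
  ∃[ q ] (q * b ≤ k × P (k ∸ q * b) × (∀ q′ → q < q′ → q′ * b ≤ k → ¬ P (k ∸ q′ * b)))
greedyQuotient P? {b} b>0 k Pk with largest (λ q → q * b ≤? k ×-dec P? (k ∸ q * b)) (z≤n , Pk) k
... | q , _ , (qb≤k , Pr) , above =
  q , qb≤k , Pr , λ q′ q<q′ q′b≤k P′ → above q′ q<q′ (q′≤k q′ q′b≤k) (q′b≤k , P′)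
  where
  q′≤k : ∀ q′ → q′ * b ≤ k → q′ ≤ k
  q′≤k q′ = ≤-trans (m≤m*n q′ b {{>-nonZero b>0}})

-- MinCost (y + x) > MinCost y, phrased so that minimal representations need not exist.
Costly : List ℕ → ℕ → Set
Costly C x = ∀ y a → y ≢ 1 → IsRep C (y + x) a → ∃[ a′ ] (IsRep C y a′ × cost a′ < cost a)

Costly-* : ∀ {C x} → 2 ≤ x → Costly C x → ∀ d y a → y ≢ 1 → IsRep C (y + d * x) a →
           ∃[ a′ ] (IsRep C y a′ × d + cost a′ ≤ cost a)
Costly-* _ _ zero y a _ (len , eq) = a , (len , trans eq (+-identityʳ y)) , ≤-refl
Costly-* {x = x} x≥2 costly (suc d) y a y≢1 (len , eq)
  with Costly-* x≥2 costly d (y + x) a (≥2⇒≢1 (≤-trans x≥2 (m≤n+m x y)))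
                 (len , trans eq (sym (+-assoc y x (d * x))))
... | a₁ , rep₁ , d+a₁≤a with costly y a₁ y≢1 rep₁
...   | a′ , rep′ , a′<a₁ = a′ , rep′ , (begin
  suc d + cost a′   ≡⟨ +-suc d (cost a′) ⟨
  d + suc (cost a′) ≤⟨ +-monoʳ-≤ d a′<a₁ ⟩
  d + cost a₁       ≤⟨ d+a₁≤a ⟩
  cost a            ∎)
  where open ≤-Reasoning

Costly-fromMultiple : ∀ {C x b δ m} aδ → 2 ≤ x → Costly C x → IsRep C δ aδ → cost aδ < m →
                      b + δ ≡ m * x → Costly C b
Costly-fromMultiple {C} {x} {b} {δ} {m} aδ x≥2 costly repδ aδ<m b+δ≡mx y a y≢1 rep
  with Costly-* x≥2 costly m y (zipWith _+_ a aδ) y≢1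
         (subst (λ k → IsRep C k (zipWith _+_ a aδ)) (trans (+-assoc y b δ) (cong (y +_) b+δ≡mx))
                (IsRep-+ a aδ rep repδ))
... | a′ , rep′ , m+a′≤a+aδ = a′ , rep′ , +-cancelˡ-≤ (cost aδ) _ _ (begin
  cost aδ + suc (cost a′)        ≡⟨ +-suc (cost aδ) (cost a′) ⟩
  suc (cost aδ) + cost a′        ≤⟨ +-monoˡ-≤ (cost a′) aδ<m ⟩
  m + cost a′                    ≤⟨ m+a′≤a+aδ ⟩
  cost (zipWith _+_ a aδ)        ≡⟨ cost-zipWith-+ a aδ (trans (proj₁ rep) (sym (proj₁ repδ))) ⟩
  cost a + cost aδ               ≡⟨ +-comm (cost a) (cost aδ) ⟩
  cost aδ + cost a               ∎)
  where open ≤-Reasoning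

drop-coin : ∀ {C b y} j a → IsRep (b ∷ C) (y + b) (suc j ∷ a) → IsRep (b ∷ C) y (j ∷ a)
drop-coin {C} {b} {y} j a (len , eq) =
  len , +-cancelˡ-≡ b _ _ (trans (sym (+-assoc b (j * b) (dot a C))) (trans eq (+-comm y b)))

Costly-∷ : ∀ {C b} → Costly C b → Costly (b ∷ C) b
Costly-∷ costly y []          _   (() , _)
Costly-∷ {b = b} costly y (suc j ∷ a) _   rep = j ∷ a , drop-coin {b = b} j a rep , ≤-refl
Costly-∷ costly y (zero ∷ a)  y≢1 (len , eq) with costly y a y≢1 (suc-injective len , eq)
... | a′ , (len′ , eq′) , a′<a = zero ∷ a′ , (cong suc len′ , eq′) , a′<a

x≡r+[q∸j]*b : ∀ {j q b x r k} → j ≤ q → j * b + x ≡ k → q * b + r ≡ k → x ≡ r + (q ∸ j) * b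
x≡r+[q∸j]*b {j} {q} {b} {x} {r} {k} j≤q jb+x≡k qb+r≡k = +-cancelˡ-≡ (j * b) x _ (begin
  j * b + x                     ≡⟨ jb+x≡k ⟩
  k                             ≡⟨ qb+r≡k ⟨
  q * b + r                     ≡⟨ cong (λ n → n * b + r) (m+[n∸m]≡n j≤q) ⟨
  (j + (q ∸ j)) * b + r         ≡⟨ cong (_+ r) (*-distribʳ-+ b j (q ∸ j)) ⟩
  (j * b + (q ∸ j) * b) + r     ≡⟨ +-assoc (j * b) _ r ⟩
  j * b + ((q ∸ j) * b + r)     ≡⟨ cong (j * b +_) (+-comm ((q ∸ j) * b) r) ⟩
  j * b + (r + (q ∸ j) * b)     ∎)
  where open ≡-Reasoning

more-threes-cheaper : ∀ {q h j i} → j ≤ q → j * 3 + i * 2 ≡ q * 3 + h * 2 → q + h ≤ j + i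
more-threes-cheaper {q} {h} {zero} {i} _ eq = *-cancelʳ-≤ (q + h) i 2 (begin
  (q + h) * 2      ≡⟨ *-distribʳ-+ 2 q h ⟩
  q * 2 + h * 2    ≤⟨ +-monoˡ-≤ (h * 2) (*-monoʳ-≤ q (n≤1+n 2)) ⟩
  q * 3 + h * 2    ≡⟨ eq ⟨
  i * 2            ∎)
  where open ≤-Reasoning
more-threes-cheaper {suc q} {j = suc j} (s≤s j≤q) eq =
  s≤s (more-threes-cheaper j≤q (suc-injective (suc-injective (suc-injective eq))))

greedy-remainder-even : ∀ {k q} → q * 3 ≤ k → k ∸ q * 3 ≢ 1 →
                        (∀ q′ → q < q′ → q′ * 3 ≤ k → ¬ (k ∸ q′ * 3 ≢ 1)) →
                        ∃[ h ] (k ∸ q * 3 ≡ h * 2)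
greedy-remainder-even {k} {q} 3q≤k r≢1 maximal = even r≢1 stuck
  where
  stuck : 3 ≤ k ∸ q * 3 → ¬ (k ∸ q * 3 ∸ 3 ≢ 1)
  stuck 3≤r = subst (λ n → ¬ (n ≢ 1)) (sym r∸3≡) (maximal (suc q) ≤-refl 3[1+q]≤k)
    where
    r∸3≡ : k ∸ q * 3 ∸ 3 ≡ k ∸ suc q * 3
    r∸3≡ = trans (∸-+-assoc k (q * 3) 3) (cong (k ∸_) (+-comm (q * 3) 3))
    3[1+q]≤k : suc q * 3 ≤ k
    3[1+q]≤k = subst (_≤ k) (+-comm (q * 3) 3)
                 (≤-trans (+-monoʳ-≤ (q * 3) 3≤r) (≤-reflexive (m+[n∸m]≡n 3q≤k)))

  even : ∀ {r} → r ≢ 1 → (3 ≤ r → ¬ (r ∸ 3 ≢ 1)) → ∃[ h ] (r ≡ h * 2)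
  even {0} _ _ = 0 , refl
  even {1} r≢1 _ = contradiction refl r≢1
  even {2} _ _ = 1 , refl
  even {3} _ stuck = contradiction (λ ()) (stuck ≤-refl)
  even {4} _ _ = 2 , refl
  even {suc (suc (suc (suc (suc r))))} _ stuck = contradiction (λ ()) (stuck (s≤s (s≤s (s≤s z≤n))))

Costly-3∷2 : Costly (3 ∷ 2 ∷ []) 3
Costly-3∷2 y (suc j ∷ a) _ rep = j ∷ a , drop-coin {b = 3} j a rep , ≤-refl
Costly-3∷2 y (zero ∷ i ∷ []) y≢1 (_ , eq) = from-twos i (trans eq (+-comm y 3))
  where
  from-twos : ∀ i → i * 2 + 0 ≡ 3 + y → ∃[ a′ ] (IsRep (3 ∷ 2 ∷ []) y a′ × cost a′ < i + 0)
  from-twos 2 eq = contradiction (sym (suc-injective (suc-injective (suc-injective eq)))) y≢1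
  from-twos (suc (suc (suc i))) eq =
    1 ∷ i ∷ [] , (refl , suc-injective (suc-injective (suc-injective eq))) , s≤s (s≤s (n≤1+n _))
Costly-3∷2 y [] _ (() , _)
Costly-3∷2 y (zero ∷ []) _ (() , _)
Costly-3∷2 y (zero ∷ _ ∷ _ ∷ _) _ (() , _)

fib≥1 : ∀ n → 1 ≤ fib n
fib≥1 zero                = ≤-refl
fib≥1 (suc zero)          = ≤-refl
fib≥1 (suc (suc n))       = ≤-trans (fib≥1 (suc n)) (m≤m+n _ _)

coin : ℕ → ℕ
coin i = fib (suc (suc i))

coin≥2 : ∀ i → 2 ≤ coin i
coin≥2 i = +-mono-≤ (fib≥1 (suc i)) (fib≥1 i)

-- [F_{n+2}, …, F_2]: the generators of fibSet (n + 2) in the order the greedy algorithm scans them.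
fibCoins : ℕ → List ℕ
fibCoins n = applyDownFrom coin (suc n)

fibCoins≥2 : ∀ n → All (2 ≤_) (fibCoins n)
fibCoins≥2 n = applyDownFrom⁺₂ coin (suc n) coin≥2

reverse-fibSet : ∀ n → reverse (fibSet (2 + n)) ≡ fibCoins n
reverse-fibSet n = trans (cong reverse (map-upTo coin (suc n))) (reverse-applyUpTo coin (suc n))

fibSet-InSG⇒≢1 : ∀ t {x} → InSG (fibSet t) x → x ≢ 1
fibSet-InSG⇒≢1 t (a , _ , eq) = subst (_≢ 1) eq (dot≢1 (map⁺ (universal coin≥2 _)) a)

fib[5+n]+fib[2+n]≡2*fib[4+n] : ∀ n → fib (5 + n) + fib (2 + n) ≡ 2 * fib (4 + n)
fib[5+n]+fib[2+n]≡2*fib[4+n] n = shuffle (fib (3 + n)) (fib (2 + n))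
  where
  shuffle : ∀ b a → ((b + a) + b) + a ≡ 2 * (b + a)
  shuffle = solve-∀

-- F_4 + (2 + 2) = 3·F_3, and F_{n+1} + F_{n−2} = 2·F_n with F_{n−2} a single coin.
Costly-next : ∀ m → Costly (fibCoins (suc m)) (coin (suc m)) → Costly (fibCoins (suc m)) (coin (2 + m))
Costly-next zero costly = Costly-fromMultiple (0 ∷ 2 ∷ []) (coin≥2 1) costly (refl , refl) ≤-refl refl
Costly-next (suc m) costly =
  Costly-fromMultiple (0 ∷ 0 ∷ 1 ∷ zeros rest) (coin≥2 (2 + m)) costly
    (cong (3 +_) (proj₁ (IsRep-zeros rest)) ,
     trans (cong₂ _+_ (+-identityʳ (coin m)) (proj₂ (IsRep-zeros rest))) (+-identityʳ (coin m)))
    (s≤s (s≤s (≤-reflexive (cost-zeros rest))))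
    (fib[5+n]+fib[2+n]≡2*fib[4+n] m)
  where
  rest : List ℕ
  rest = applyDownFrom coin m

fibCoins-costly : ∀ m → Costly (fibCoins (suc m)) (coin (suc m))
fibCoins-costly zero    = Costly-3∷2
fibCoins-costly (suc m) = Costly-∷ (Costly-next m (fibCoins-costly m))

module Greedy (S : List ℕ)
              (InSG⇒≢1 : ∀ {x} → InSG S x → x ≢ 1) (≢1⇒InSG : ∀ {x} → x ≢ 1 → InSG S x) where

  InSG? : Decidable (InSG S)
  InSG? x = map′ ≢1⇒InSG InSG⇒≢1 (¬? (x ≟ 1))

  GreedyOptimal : List ℕ → Set
  GreedyOptimal C = ∀ k → k ≢ 1 → ∃[ c ] (GreedyRun S C k c × IsMinCost C k c)

  greedy-∷ : ∀ {C b} → All (2 ≤_) C → 2 ≤ b → GreedyOptimal C → Costly C b → GreedyOptimal (b ∷ C)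
  greedy-∷ _ _ _ _ zero _ = 0 , done , IsMinCost-0 _
  greedy-∷ {C} {b} C≥2 b≥2 optimal costly k@(suc _) k≢1
    with greedyQuotient InSG? (≤-trans (n≤1+n 1) b≥2) k (≢1⇒InSG k≢1)
  ... | q , qb≤k , r∈S , maximal with optimal (k ∸ q * b) (InSG⇒≢1 r∈S)
  ...   | c , run , ((ar , (len-r , eq-r) , cost-ar) , minimal-r) =
    q + c , step z<s qb≤k r∈S maximal run ,
    (q ∷ ar , (cong suc len-r , trans (cong (q * b +_) eq-r) qb+r≡k) , cong (q +_) cost-ar) , lower-bound
    where
    qb+r≡k : q * b + (k ∸ q * b) ≡ k
    qb+r≡k = m+[n∸m]≡n qb≤k

    lower-bound : ∀ a → IsRep (b ∷ C) k a → q + c ≤ cost a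
    lower-bound []       (() , _)
    lower-bound (j ∷ as) (len , eq) with j ≤? q
    ... | no j≰q = contradiction (≢1⇒InSG (subst (_≢ 1) rest≡ (dot≢1 C≥2 as)))
                     (maximal j (≰⇒> j≰q) (≤-trans (m≤m+n (j * b) _) (≤-reflexive eq)))
      where
      rest≡ : dot as C ≡ k ∸ j * b
      rest≡ = trans (sym (m+n∸m≡n (j * b) (dot as C))) (cong (_∸ j * b) eq)
    ... | yes j≤q with Costly-* b≥2 costly (q ∸ j) (k ∸ q * b) as (InSG⇒≢1 r∈S)
                         (suc-injective len , x≡r+[q∸j]*b j≤q eq qb+r≡k)
    ...   | a′ , rep′ , q∸j+a′≤as = begin
      q + c                  ≡⟨ cong (_+ c) (m+[n∸m]≡n j≤q) ⟨
      j + (q ∸ j) + c        ≡⟨ +-assoc j (q ∸ j) c ⟩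
      j + ((q ∸ j) + c)      ≤⟨ +-monoʳ-≤ j (+-monoʳ-≤ (q ∸ j) (minimal-r a′ rep′)) ⟩
      j + ((q ∸ j) + cost a′) ≤⟨ +-monoʳ-≤ j q∸j+a′≤as ⟩
      j + cost as            ∎
      where open ≤-Reasoning

  greedyRun-2 : ∀ h → GreedyRun S (2 ∷ []) (h * 2) h
  greedyRun-2 zero = done
  greedyRun-2 (suc h) = subst (GreedyRun S (2 ∷ []) (suc h * 2)) (+-identityʳ (suc h))
    (step z<s ≤-refl (subst (InSG S) (sym (n∸n≡0 (suc h * 2))) (≢1⇒InSG λ ())) no-larger
      (subst (λ r → GreedyRun S [] r 0) (sym (n∸n≡0 (suc h * 2))) done))
    where
    no-larger : ∀ q′ → suc h < q′ → q′ * 2 ≤ suc h * 2 → ¬ InSG S (suc h * 2 ∸ q′ * 2)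
    no-larger q′ h<q′ q′2≤h2 _ = <⇒≱ h<q′ (*-cancelʳ-≤ q′ (suc h) 2 q′2≤h2)

  greedy-3∷2 : GreedyOptimal (3 ∷ 2 ∷ [])
  greedy-3∷2 zero _ = 0 , done , IsMinCost-0 _
  greedy-3∷2 k@(suc _) k≢1 with greedyQuotient InSG? z<s k (≢1⇒InSG k≢1)
  ... | q , 3q≤k , r∈S , maximal
    with greedy-remainder-even 3q≤k (InSG⇒≢1 r∈S)
           (λ q′ q<q′ q′3≤k → maximal q′ q<q′ q′3≤k ∘ ≢1⇒InSG)
  ...   | h , r≡2h =
    q + h , step z<s 3q≤k r∈S maximal (subst (λ r → GreedyRun S (2 ∷ []) r h) (sym r≡2h) (greedyRun-2 h)) ,
    (q ∷ h ∷ [] , (refl , trans (cong (q * 3 +_) (+-identityʳ (h * 2))) 3q+2h≡k) ,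
     cong (q +_) (+-identityʳ h)) ,
    lower-bound
    where
    3q+2h≡k : q * 3 + h * 2 ≡ k
    3q+2h≡k = trans (cong (q * 3 +_) (sym r≡2h)) (m+[n∸m]≡n 3q≤k)

    even≢1 : ∀ i → i * 2 ≢ 1
    even≢1 (suc zero) ()

    lower-bound′ : ∀ j i → j * 3 + i * 2 ≡ k → q + h ≤ j + i
    lower-bound′ j i eq with j ≤? q
    ... | yes j≤q = more-threes-cheaper j≤q (trans eq (sym 3q+2h≡k))
    ... | no j≰q  = contradiction (≢1⇒InSG (subst (_≢ 1) rest≡ (even≢1 i)))
                      (maximal j (≰⇒> j≰q) (≤-trans (m≤m+n (j * 3) _) (≤-reflexive eq)))
      where
      rest≡ : i * 2 ≡ k ∸ j * 3
      rest≡ = trans (sym (m+n∸m≡n (j * 3) (i * 2))) (cong (_∸ j * 3) eq)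

    lower-bound : ∀ a → IsRep (3 ∷ 2 ∷ []) k a → q + h ≤ cost a
    lower-bound (j ∷ i ∷ []) (_ , eq) =
      subst (q + h ≤_) (cong (j +_) (sym (+-identityʳ i)))
        (lower-bound′ j i (trans (cong (j * 3 +_) (sym (+-identityʳ (i * 2)))) eq))
    lower-bound []              (() , _)
    lower-bound (_ ∷ [])        (() , _)
    lower-bound (_ ∷ _ ∷ _ ∷ _) (() , _)

  greedyOptimal⇒IsGreedy : GreedyOptimal (reverse S) → IsGreedy S
  greedyOptimal⇒IsGreedy optimal k k∈S with optimal k (InSG⇒≢1 k∈S)
  ... | c , run , minimal = c , run , IsMinCost-reverse minimal

  fibCoins-greedy : ∀ m → GreedyOptimal (fibCoins (suc m))
  fibCoins-greedy zero    = greedy-3∷2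
  fibCoins-greedy (suc m) =
    greedy-∷ (fibCoins≥2 (suc m)) (coin≥2 (2 + m)) (fibCoins-greedy m) (Costly-next m (fibCoins-costly m))

theorem6 : ∀ (t : ℕ) → 3 ≤ t → IsGreedy (fibSet t)
theorem6 (suc (suc (suc m))) (s≤s (s≤s (s≤s z≤n))) =
  greedyOptimal⇒IsGreedy (subst GreedyOptimal (sym (reverse-fibSet (suc m))) (fibCoins-greedy m))
  where
  open Greedy (fibSet (3 + m)) (fibSet-InSG⇒≢1 (3 + m)) (≢1⇒InSG _)
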